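{- Let $q=p^\beta=ef+1$ be a prime power with $e,f>1$, and suppose $C_0^e$ is a proper $(q,f,\lambda,\mu)$-partial difference set. Then (i) if $e>f$, $C_0^e\cup\{0\}$ is a subfield of $GF(q)$; (ii) if $e<f$, $C_0^e\cup\{0\}$ is not a subfield of $GF(q)$ and $\mu\ge1$; (iii) the case $e=f$ cannot occur for $f>2$.
   Context: $\alpha$ is a primitive element of $GF(q)$ and $C_0^e=\langle\alpha^e\rangle$. A subset $P\subseteq GF(q)$ with $|P|=k$ is a $(q,k,\lambda,\mu)$-partial difference set if the multiset $\{x-y:x,y\in P,x\neq y\}$ consists of $\lambda$ copies of each element of $P$ and $\mu$ copies of each element of $GF(q)\setminus(P\cup\{0\})$; it is proper if $\lambda\neq\mu$. -}

module Defs where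

open import Level using (0ℓ)
open import Data.Nat using (ℕ; zero; suc)
open import Data.Fin using (Fin)
open import Data.List using (List; length; filter; allFin; map; cartesianProduct)
open import Data.Product using (∃; _×_; _,_; proj₁; proj₂)
open import Data.Sum using (_⊎_)
open import Relation.Nullary using (¬_; Dec; _×-dec_)
open import Relation.Unary using (Pred; Decidable)
open import Relation.Binary.PropositionalEquality using (_≡_; _≢_; ≡-≟-identity)
open import Relation.Binary.Definitions using (DecidableEquality)
open import Algebra.Core using (Op₁; Op₂)
open import Algebra.Structures using (IsCommutativeRing)
open import Function.Bundles using (_↔_; Inverse)

-- Every finite field of order q is (isomorphic to) GF(q).
record FiniteField (q : ℕ) : Set₁ where
  infixl 7 _*_
  infixl 6 _+_
  infix  8 -_
  field
    Carrier           : Set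
    _+_ _*_           : Op₂ Carrier
    -_                : Op₁ Carrier
    0# 1#             : Carrier
    isCommutativeRing : IsCommutativeRing _≡_ _+_ _*_ -_ 0# 1#
    0≢1               : 0# ≢ 1#
    inverse           : ∀ x → x ≢ 0# → ∃ λ y → x * y ≡ 1#
    _≟_               : DecidableEquality Carrier
    enum              : Carrier ↔ Fin q

module FieldDefs {q : ℕ} (F : FiniteField q) where
  open FiniteField F

  infixl 6 _-_
  _-_ : Op₂ Carrier
  x - y = x + (- y)

  infixr 8 _^_
  _^_ : Carrier → ℕ → Carrier
  x ^ zero  = 1#
  x ^ suc n = x * (x ^ n)

  elements : List Carrier
  elements = map (Inverse.from enum) (allFin q)

  Primitive : Carrier → Set
  Primitive α = ∀ x → x ≢ 0# → ∃ λ i → x ≡ α ^ i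

  -- C_0^e = ⟨α^e⟩, the (multiplicative) subgroup generated by α^e
  -- (in a finite group the cyclic subgroup is the set of natural powers)
  C₀ : Carrier → ℕ → Pred Carrier 0ℓ
  C₀ α e x = ∃ λ i → x ≡ (α ^ e) ^ i

  card : {P : Pred Carrier 0ℓ} → Decidable P → ℕ
  card P? = length (filter P? elements)

  diffCount : {P : Pred Carrier 0ℓ} → Decidable P → Carrier → ℕ
  diffCount {P} P? d =
    length (filter dec (cartesianProduct elements elements))
    where
      Good : Carrier × Carrier → Set
      Good (x , y) = P x × P y × ¬ (x ≡ y) × (x - y ≡ d)
      dec : Decidable Good
      dec (x , y) = P? x ×-dec (P? y ×-dec (Relation.Nullary.¬? (x ≟ y) ×-dec ((x - y) ≟ d)))

  IsPDS : {P : Pred Carrier 0ℓ} → Decidable P → ℕ → ℕ → ℕ → Set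
  IsPDS {P} P? k λ' μ =
    card P? ≡ k
    × (∀ d → P d → diffCount P? d ≡ λ')
    × (∀ d → d ≢ 0# → ¬ P d → diffCount P? d ≡ μ)

  IsProperPDS : {P : Pred Carrier 0ℓ} → Decidable P → ℕ → ℕ → ℕ → Set
  IsProperPDS P? k λ' μ = IsPDS P? k λ' μ × ¬ (λ' ≡ μ)

  IsSubfield : Pred Carrier 0ℓ → Set
  IsSubfield S =
    S 0# × S 1#
    × (∀ x y → S x → S y → S (x + y))
    × (∀ x → S x → S (- x))
    × (∀ x y → S x → S y → S (x * y))
    × (∀ x (x≢0 : x ≢ 0#) → S x → S (proj₁ (inverse x x≢0)))

  C₀∪0 : Carrier → ℕ → Pred Carrier 0ℓ
  C₀∪0 α e x = x ≡ 0# ⊎ C₀ α e x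

-- Counting the f (f - 1) ordered pairs of distinct elements of C = C₀ᵉ by their differences gives
-- f - 1 = λ + μ (e - 1).  For e > f this forces μ = 0: every difference of distinct elements of C
-- lies in C, so -1 = (c - 1)/(1 - c) ∈ C and C ∪ {0} is closed under addition and negation, hence
-- a subfield.  Conversely, a subfield K and an element t ∉ K give |K|² ≤ q, since (a , b) ↦ a + t b
-- is injective on K × K; with |K| = f + 1 and q = e f + 1 this rules out a subfield when e ≤ f,
-- and then μ ≥ 1 as well.  For e = f the relation leaves only μ = 0, again impossible, or μ = 1
-- and λ = 0, which for f > 2 produces a difference lying in C or one represented twice.

module Submission where

open import Defs
open import Level using (0ℓ)
open import Data.Nat using (ℕ; zero; suc; _+_; _*_; _≤_; _<_; _>_; _<?_; z≤n; s≤s; z<s; pred; NonZero; >-nonZero)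
open import Data.Nat.Properties hiding (_≟_)
open import Data.Nat.Primality using (Prime)
open import Data.Nat.Tactic.RingSolver using (solve-∀)
open import Data.Fin using (Fin; zero; suc)
import Data.Fin.Properties as Fin
open import Data.List using (List; _++_; length; filter; map; tabulate; allFin; cartesianProduct)
open import Data.List.Properties using (filter-++; length-++; map-tabulate)
open import Data.Product using (∃; ∃₂; _×_; _,_; proj₁; proj₂)
open import Data.Sum using (_⊎_; inj₁; inj₂)
open import Data.Empty using (⊥; ⊥-elim)
open import Function using (_∘_)
open import Function.Bundles using (_↔_; Inverse)
open import Algebra.Bundles using (CommutativeRing)
import Algebra.Properties.Ring
open import Relation.Nullary using (¬_; Dec; yes; no; _×-dec_; _⊎-dec_; ¬?)
open import Relation.Unary using (Pred; Decidable)
open import Relation.Binary.Definitions using (DecidableEquality)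
open import Relation.Binary.PropositionalEquality
open import Algebra.Properties.Semiring.Sum +-*-semiring
  using (sum; sum-cong-≗; sum-replicate-zero; *-distribˡ-sum)
  renaming (∑-distrib-+ to sum-distrib-+; ∑-comm to sum-comm)

⟦_⟧ : ∀ {p} {P : Set p} → Dec P → ℕ
⟦ yes _ ⟧ = 1
⟦ no _ ⟧  = 0

module _ {p} {P : Set p} where

  ⟦⟧-yes : (d : Dec P) → P → ⟦ d ⟧ ≡ 1
  ⟦⟧-yes (yes _) _  = refl
  ⟦⟧-yes (no ¬p) p = ⊥-elim (¬p p)

  ⟦⟧-no : (d : Dec P) → ¬ P → ⟦ d ⟧ ≡ 0
  ⟦⟧-no (yes p) ¬p = ⊥-elim (¬p p)
  ⟦⟧-no (no _)  _  = refl

  ⟦⟧≤1 : (d : Dec P) → ⟦ d ⟧ ≤ 1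
  ⟦⟧≤1 (yes _) = s≤s z≤n
  ⟦⟧≤1 (no _)  = z≤n

  ⟦⟧-sound : (d : Dec P) → 0 < ⟦ d ⟧ → P
  ⟦⟧-sound (yes p) _ = p

  ⟦⟧-idem : (d : Dec P) → ⟦ d ⟧ * ⟦ d ⟧ ≡ ⟦ d ⟧
  ⟦⟧-idem (yes _) = refl
  ⟦⟧-idem (no _)  = refl

  ⟦⟧+⟦¬⟧ : (d : Dec P) → ⟦ d ⟧ + ⟦ ¬? d ⟧ ≡ 1
  ⟦⟧+⟦¬⟧ (yes _) = refl
  ⟦⟧+⟦¬⟧ (no _)  = refl

module _ {p r} {P : Set p} {R : Set r} where

  ⟦×-dec⟧ : (d : Dec P) (d′ : Dec R) → ⟦ d ×-dec d′ ⟧ ≡ ⟦ d ⟧ * ⟦ d′ ⟧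
  ⟦×-dec⟧ (yes _) (yes _) = refl
  ⟦×-dec⟧ (yes _) (no _)  = refl
  ⟦×-dec⟧ (no _)  _       = refl

  ⟦⊎-dec⟧ : (d : Dec P) (d′ : Dec R) → (P → ¬ R) → ⟦ d ⊎-dec d′ ⟧ ≡ ⟦ d ⟧ + ⟦ d′ ⟧
  ⟦⊎-dec⟧ (yes p) (yes r) disj = ⊥-elim (disj p r)
  ⟦⊎-dec⟧ (yes _) (no _)  _    = refl
  ⟦⊎-dec⟧ (no _)  (yes _) _    = refl
  ⟦⊎-dec⟧ (no _)  (no _)  _    = refl

  ⟦⟧≤⟦×-dec-¬⟧+⟦⟧ : (d : Dec P) (d′ : Dec R) → ⟦ d ⟧ ≤ ⟦ d ×-dec ¬? d′ ⟧ + ⟦ d′ ⟧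
  ⟦⟧≤⟦×-dec-¬⟧+⟦⟧ (yes _) (yes _) = s≤s z≤n
  ⟦⟧≤⟦×-dec-¬⟧+⟦⟧ (yes _) (no _)  = s≤s z≤n
  ⟦⟧≤⟦×-dec-¬⟧+⟦⟧ (no _)  _       = z≤n

  ⟦⟧-trichotomy : (d : Dec P) (d′ : Dec R) → (P → ¬ R) → ⟦ d ⟧ + ⟦ d′ ⟧ + ⟦ ¬? d ×-dec ¬? d′ ⟧ ≡ 1
  ⟦⟧-trichotomy (yes p) (yes r) disj = ⊥-elim (disj p r)
  ⟦⟧-trichotomy (yes _) (no _)  _    = refl
  ⟦⟧-trichotomy (no _)  (yes _) _    = refl
  ⟦⟧-trichotomy (no _)  (no _)  _    = refl

  ⟦⟧-split : (d : Dec P) (d′ : Dec R) → ⟦ d ×-dec ¬? d′ ⟧ + ⟦ d′ ⟧ * ⟦ d ⟧ ≡ ⟦ d ⟧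
  ⟦⟧-split (yes _) (yes _) = refl
  ⟦⟧-split (yes _) (no _)  = refl
  ⟦⟧-split (no _)  (yes _) = refl
  ⟦⟧-split (no _)  (no _)  = refl

⟦×-dec⟧-last : ∀ {a b c d} {A : Set a} {B : Set b} {C : Set c} {D : Set d}
  (a? : Dec A) (b? : Dec B) (c? : Dec C) (d? : Dec D) →
  ⟦ a? ×-dec (b? ×-dec (c? ×-dec d?)) ⟧ ≡ ⟦ a? ×-dec (b? ×-dec c?) ⟧ * ⟦ d? ⟧
⟦×-dec⟧-last (no _)  _       _       _       = refl
⟦×-dec⟧-last (yes _) (no _)  _       _       = refl
⟦×-dec⟧-last (yes _) (yes _) (no _)  _       = refl
⟦×-dec⟧-last (yes _) (yes _) (yes _) (yes _) = refl
⟦×-dec⟧-last (yes _) (yes _) (yes _) (no _)  = refl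

sum-mono : ∀ {n} {g h : Fin n → ℕ} → (∀ i → g i ≤ h i) → sum g ≤ sum h
sum-mono {zero}  _   = z≤n
sum-mono {suc n} g≤h = +-mono-≤ (g≤h zero) (sum-mono (g≤h ∘ suc))

sum-one : ∀ n → sum {n} (λ _ → 1) ≡ n
sum-one zero    = refl
sum-one (suc n) = cong suc (sum-one n)

sum-single : ∀ {n} (g : Fin n → ℕ) j → (∀ i → i ≢ j → g i ≡ 0) → sum g ≡ g j
sum-single {suc n} g zero    others = begin
  g zero + sum (g ∘ suc)        ≡⟨ cong (g zero +_) (sum-cong-≗ (λ i → others (suc i) (λ ()))) ⟩
  g zero + sum {n} (λ _ → 0)    ≡⟨ cong (g zero +_) (sum-replicate-zero n) ⟩
  g zero + 0                    ≡⟨ +-identityʳ (g zero) ⟩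
  g zero                        ∎
  where open ≡-Reasoning
sum-single {suc n} g (suc j) others =
  cong₂ _+_ (others zero (λ ()))
            (sum-single (g ∘ suc) j (λ i i≢j → others (suc i) (i≢j ∘ Fin.suc-injective)))

sum-pos : ∀ {n} (g : Fin n → ℕ) → 0 < sum g → ∃ λ i → 0 < g i
sum-pos {suc n} g pos with g zero in eq
... | suc _ = zero , subst (0 <_) (sym eq) (s≤s z≤n)
... | zero  with sum-pos (g ∘ suc) pos
...   | i , gi>0 = suc i , gi>0

module _ {a} {A : Set a} {P : Pred A a} (P? : Decidable P) where

  length-filter-tabulate : ∀ {n} (t : Fin n → A) →
    length (filter P? (tabulate t)) ≡ sum (λ i → ⟦ P? (t i) ⟧)
  length-filter-tabulate {zero}  t = refl
  length-filter-tabulate {suc n} t with P? (t zero)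
  ... | yes _ = cong suc (length-filter-tabulate (t ∘ suc))
  ... | no _  = length-filter-tabulate (t ∘ suc)

module _ {a} {A B : Set a} {P : Pred (A × B) a} (P? : Decidable P) where

  length-filter-cartesianProduct : ∀ {m n} (t : Fin m → A) (u : Fin n → B) →
    length (filter P? (cartesianProduct (tabulate t) (tabulate u)))
      ≡ sum (λ i → sum (λ j → ⟦ P? (t i , u j) ⟧))
  length-filter-cartesianProduct {zero}  t u = refl
  length-filter-cartesianProduct {suc m} t u = begin
    length (filter P? (map (t zero ,_) (tabulate u) ++ rest))
      ≡⟨ cong length (filter-++ P? (map (t zero ,_) (tabulate u)) rest) ⟩
    length (filter P? (map (t zero ,_) (tabulate u)) ++ filter P? rest)
      ≡⟨ length-++ (filter P? (map (t zero ,_) (tabulate u))) ⟩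
    length (filter P? (map (t zero ,_) (tabulate u))) + length (filter P? rest)
      ≡⟨ cong₂ _+_ (trans (cong (length ∘ filter P?) (map-tabulate u (t zero ,_)))
                          (length-filter-tabulate P? (λ j → t zero , u j)))
                   (length-filter-cartesianProduct (t ∘ suc) u) ⟩
    sum (λ i → sum (λ j → ⟦ P? (t i , u j) ⟧)) ∎
    where
    open ≡-Reasoning
    rest : List (A × B)
    rest = cartesianProduct (tabulate (t ∘ suc)) (tabulate u)

module Enumerated {A : Set} {n : ℕ} (enum : A ↔ Fin n) (_≟_ : DecidableEquality A) where

  open Inverse enum using (to; from)

  ∑ : (A → ℕ) → ℕ
  ∑ h = sum (h ∘ from)

  ∑-cong : ∀ {g h : A → ℕ} → (∀ x → g x ≡ h x) → ∑ g ≡ ∑ h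
  ∑-cong g≡h = sum-cong-≗ (g≡h ∘ from)

  ∑-mono : ∀ {g h : A → ℕ} → (∀ x → g x ≤ h x) → ∑ g ≤ ∑ h
  ∑-mono g≤h = sum-mono (g≤h ∘ from)

  ∑-distrib-+ : ∀ (g h : A → ℕ) → ∑ (λ x → g x + h x) ≡ ∑ g + ∑ h
  ∑-distrib-+ g h = sum-distrib-+ (g ∘ from) (h ∘ from)

  ∑-*ˡ : ∀ c (h : A → ℕ) → ∑ (λ x → c * h x) ≡ c * ∑ h
  ∑-*ˡ c h = sym (*-distribˡ-sum c (h ∘ from))

  ∑-comm : ∀ (g : A → A → ℕ) → ∑ (λ x → ∑ (λ y → g x y)) ≡ ∑ (λ y → ∑ (λ x → g x y))
  ∑-comm g = sum-comm (λ i j → g (from i) (from j))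

  ∑-one : ∑ (λ _ → 1) ≡ n
  ∑-one = sum-one n

  ∑-zero : ∑ (λ _ → 0) ≡ 0
  ∑-zero = sum-replicate-zero n

  ∑-single : ∀ a (h : A → ℕ) → (∀ x → x ≢ a → h x ≡ 0) → ∑ h ≡ h a
  ∑-single a h others = trans
    (sum-single (h ∘ from) (to a) (λ i i≢to-a → others (from i) (i≢to-a ∘ to-from-≡)))
    (cong h (from-to a))
    where
    from-to : ∀ x → from (to x) ≡ x
    from-to = Inverse.strictlyInverseʳ enum
    to-from-≡ : ∀ {i x} → from i ≡ x → i ≡ to x
    to-from-≡ {i} refl = sym (Inverse.strictlyInverseˡ enum i)

  ∑-point : ∀ a (h : A → ℕ) → ∑ (λ x → ⟦ a ≟ x ⟧ * h x) ≡ h a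
  ∑-point a h = trans
    (∑-single a _ (λ x x≢a → cong (_* h x) (⟦⟧-no (a ≟ x) (x≢a ∘ sym))))
    (trans (cong (_* h a) (⟦⟧-yes (a ≟ a) refl)) (+-identityʳ (h a)))

  ∑-indicator : ∀ a → ∑ (λ x → ⟦ x ≟ a ⟧) ≡ 1
  ∑-indicator a = trans (∑-single a _ (λ x → ⟦⟧-no (x ≟ a))) (⟦⟧-yes (a ≟ a) refl)

  ∑-≥ : ∀ (h : A → ℕ) a → h a ≤ ∑ h
  ∑-≥ h a = begin
    h a                          ≡⟨ sym (∑-point a h) ⟩
    ∑ (λ x → ⟦ a ≟ x ⟧ * h x)    ≤⟨ ∑-mono (λ x → *-monoˡ-≤ (h x) (⟦⟧≤1 (a ≟ x))) ⟩
    ∑ (λ x → 1 * h x)            ≡⟨ ∑-cong (λ x → *-identityˡ (h x)) ⟩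
    ∑ h                          ∎
    where open ≤-Reasoning

  ∑-≥₂ : ∀ (h : A → ℕ) {a b} → a ≢ b → h a + h b ≤ ∑ h
  ∑-≥₂ h {a} {b} a≢b = begin
    h a + h b
      ≡⟨ sym (cong₂ _+_ (∑-point a h) (∑-point b h)) ⟩
    ∑ (λ x → ⟦ a ≟ x ⟧ * h x) + ∑ (λ x → ⟦ b ≟ x ⟧ * h x)
      ≡⟨ sym (∑-distrib-+ (λ x → ⟦ a ≟ x ⟧ * h x) (λ x → ⟦ b ≟ x ⟧ * h x)) ⟩
    ∑ (λ x → ⟦ a ≟ x ⟧ * h x + ⟦ b ≟ x ⟧ * h x)
      ≡⟨ ∑-cong (λ x → sym (*-distribʳ-+ (h x) ⟦ a ≟ x ⟧ ⟦ b ≟ x ⟧)) ⟩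
    ∑ (λ x → (⟦ a ≟ x ⟧ + ⟦ b ≟ x ⟧) * h x)
      ≤⟨ ∑-mono (λ x → *-monoˡ-≤ (h x) (at-most-one x)) ⟩
    ∑ (λ x → 1 * h x)
      ≡⟨ ∑-cong (λ x → *-identityˡ (h x)) ⟩
    ∑ h ∎
    where
    open ≤-Reasoning
    at-most-one : ∀ x → ⟦ a ≟ x ⟧ + ⟦ b ≟ x ⟧ ≤ 1
    at-most-one x with a ≟ x | b ≟ x
    ... | yes refl | yes refl = ⊥-elim (a≢b refl)
    ... | yes _    | no _     = s≤s z≤n
    ... | no _     | yes _    = s≤s z≤n
    ... | no _     | no _     = z≤n

  ∑-pos : ∀ (h : A → ℕ) → 0 < ∑ h → ∃ λ x → 0 < h x
  ∑-pos h pos with sum-pos (h ∘ from) pos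
  ... | i , hi>0 = from i , hi>0

  ∃-of-∑ : ∀ {P : Pred A 0ℓ} (P? : Decidable P) → 0 < ∑ (λ x → ⟦ P? x ⟧) → ∃ P
  ∃-of-∑ P? pos with ∑-pos (λ x → ⟦ P? x ⟧) pos
  ... | x , Px>0 = x , ⟦⟧-sound (P? x) Px>0

  ∑-atMostOne : ∀ (h : A → ℕ) → (∀ x → h x ≤ 1) → (∀ x y → 0 < h x → 0 < h y → x ≡ y) → ∑ h ≤ 1
  ∑-atMostOne h h≤1 unique with 0 <? ∑ h
  ... | no ∑h≯0 = ≤-trans (≮⇒≥ ∑h≯0) z≤n
  ... | yes ∑h>0 with ∑-pos h ∑h>0
  ...   | a , ha>0 = ≤-trans (∑-mono below-indicator) (≤-reflexive (∑-indicator a))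
    where
    below-indicator : ∀ x → h x ≤ ⟦ x ≟ a ⟧
    below-indicator x with x ≟ a | h x in hx
    ... | yes _   | _     = subst (_≤ 1) hx (h≤1 x)
    ... | no _    | zero  = z≤n
    ... | no x≢a  | suc _ = ⊥-elim (x≢a (unique x a (subst (0 <_) (sym hx) (s≤s z≤n)) ha>0))

  ∑-avoid : ∀ {P : Pred A 0ℓ} (P? : Decidable P) a {m} →
    suc m ≤ ∑ (λ x → ⟦ P? x ⟧) → m ≤ ∑ (λ x → ⟦ P? x ×-dec ¬? (x ≟ a) ⟧)
  ∑-avoid P? a {m} m<∑P = ≤-pred (begin
    suc m
      ≤⟨ m<∑P ⟩
    ∑ (λ x → ⟦ P? x ⟧)
      ≤⟨ ∑-mono (λ x → ⟦⟧≤⟦×-dec-¬⟧+⟦⟧ (P? x) (x ≟ a)) ⟩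
    ∑ (λ x → χ′ x + ⟦ x ≟ a ⟧)
      ≡⟨ ∑-distrib-+ χ′ (λ x → ⟦ x ≟ a ⟧) ⟩
    ∑ χ′ + ∑ (λ x → ⟦ x ≟ a ⟧)
      ≡⟨ cong (∑ χ′ +_) (∑-indicator a) ⟩
    ∑ χ′ + 1
      ≡⟨ +-comm (∑ χ′) 1 ⟩
    suc (∑ χ′) ∎)
    where
    open ≤-Reasoning
    χ′ : A → ℕ
    χ′ x = ⟦ P? x ×-dec ¬? (x ≟ a) ⟧

  ∃-≢ : ∀ {P : Pred A 0ℓ} (P? : Decidable P) → 1 < ∑ (λ x → ⟦ P? x ⟧) →
    ∀ a → ∃ λ x → P x × x ≢ a
  ∃-≢ P? 1<∑P a = ∃-of-∑ (λ x → P? x ×-dec ¬? (x ≟ a)) (∑-avoid P? a 1<∑P)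

  ∃-≢₂ : ∀ {P : Pred A 0ℓ} (P? : Decidable P) → 2 < ∑ (λ x → ⟦ P? x ⟧) →
    ∀ a b → ∃ λ x → P x × x ≢ a × x ≢ b
  ∃-≢₂ P? 2<∑P a b with ∃-of-∑ (λ x → (P? x ×-dec ¬? (x ≟ a)) ×-dec ¬? (x ≟ b))
                               (∑-avoid (λ x → P? x ×-dec ¬? (x ≟ a)) b (∑-avoid P? a 2<∑P))
  ... | x , (Px , x≢a) , x≢b = x , Px , x≢a , x≢b

  ∃-∉ : ∀ {P : Pred A 0ℓ} (P? : Decidable P) → ∑ (λ x → ⟦ P? x ⟧) < n → ∃ λ x → ¬ P x
  ∃-∉ P? ∑P<n = ∃-of-∑ (λ x → ¬? (P? x)) (n≢0⇒n>0 λ ∑¬P≡0 →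
    <-irrefl (trans (sym (+-identityʳ _)) (trans (cong (∑ (λ x → ⟦ P? x ⟧) +_) (sym ∑¬P≡0)) total)) ∑P<n)
    where
    total : ∑ (λ x → ⟦ P? x ⟧) + ∑ (λ x → ⟦ ¬? (P? x) ⟧) ≡ n
    total = trans (sym (∑-distrib-+ (λ x → ⟦ P? x ⟧) (λ x → ⟦ ¬? (P? x) ⟧)))
                  (trans (∑-cong (⟦⟧+⟦¬⟧ ∘ P?)) ∑-one)

  ∑-off-diagonal-row : ∀ {P : Pred A 0ℓ} (P? : Decidable P) x →
    ∑ (λ y → ⟦ P? y ×-dec ¬? (x ≟ y) ⟧) + ⟦ P? x ⟧ ≡ ∑ (λ y → ⟦ P? y ⟧)
  ∑-off-diagonal-row P? x = begin
    ∑ (λ y → ⟦ P? y ×-dec ¬? (x ≟ y) ⟧) + ⟦ P? x ⟧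
      ≡⟨ cong (∑ (λ y → ⟦ P? y ×-dec ¬? (x ≟ y) ⟧) +_) (sym (∑-point x (λ y → ⟦ P? y ⟧))) ⟩
    ∑ (λ y → ⟦ P? y ×-dec ¬? (x ≟ y) ⟧) + ∑ (λ y → ⟦ x ≟ y ⟧ * ⟦ P? y ⟧)
      ≡⟨ sym (∑-distrib-+ (λ y → ⟦ P? y ×-dec ¬? (x ≟ y) ⟧) (λ y → ⟦ x ≟ y ⟧ * ⟦ P? y ⟧)) ⟩
    ∑ (λ y → ⟦ P? y ×-dec ¬? (x ≟ y) ⟧ + ⟦ x ≟ y ⟧ * ⟦ P? y ⟧)
      ≡⟨ ∑-cong (λ y → ⟦⟧-split (P? y) (x ≟ y)) ⟩
    ∑ (λ y → ⟦ P? y ⟧) ∎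
    where open ≡-Reasoning

  ∑-off-diagonal : ∀ {P : Pred A 0ℓ} (P? : Decidable P) →
    ∑ (λ x → ∑ (λ y → ⟦ P? x ×-dec (P? y ×-dec ¬? (x ≟ y)) ⟧)) + ∑ (λ x → ⟦ P? x ⟧)
      ≡ ∑ (λ x → ⟦ P? x ⟧) * ∑ (λ x → ⟦ P? x ⟧)
  ∑-off-diagonal {P} P? = begin
    ∑ (λ x → ∑ (λ y → ⟦ P? x ×-dec R? x y ⟧)) + ∑ χ
      ≡⟨ sym (∑-distrib-+ (λ x → ∑ (λ y → ⟦ P? x ×-dec R? x y ⟧)) χ) ⟩
    ∑ (λ x → ∑ (λ y → ⟦ P? x ×-dec R? x y ⟧) + χ x)
      ≡⟨ ∑-cong row ⟩
    ∑ (λ x → ∑ χ * χ x)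
      ≡⟨ ∑-*ˡ (∑ χ) χ ⟩
    ∑ χ * ∑ χ ∎
    where
    open ≡-Reasoning
    χ : A → ℕ
    χ x = ⟦ P? x ⟧
    R? : ∀ x y → Dec (P y × x ≢ y)
    R? x y = P? y ×-dec ¬? (x ≟ y)
    row : ∀ x → ∑ (λ y → ⟦ P? x ×-dec R? x y ⟧) + χ x ≡ ∑ χ * χ x
    row x = begin
      ∑ (λ y → ⟦ P? x ×-dec R? x y ⟧) + χ x
        ≡⟨ cong₂ _+_ (∑-cong (λ y → ⟦×-dec⟧ (P? x) (R? x y))) (sym (⟦⟧-idem (P? x))) ⟩
      ∑ (λ y → χ x * ⟦ R? x y ⟧) + χ x * χ x
        ≡⟨ cong (_+ χ x * χ x) (∑-*ˡ (χ x) (λ y → ⟦ R? x y ⟧)) ⟩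
      χ x * ∑ (λ y → ⟦ R? x y ⟧) + χ x * χ x
        ≡⟨ sym (*-distribˡ-+ (χ x) (∑ (λ y → ⟦ R? x y ⟧)) (χ x)) ⟩
      χ x * (∑ (λ y → ⟦ R? x y ⟧) + χ x)
        ≡⟨ cong (χ x *_) (∑-off-diagonal-row P? x) ⟩
      χ x * ∑ χ
        ≡⟨ *-comm (χ x) (∑ χ) ⟩
      ∑ χ * χ x ∎

  ∑-trichotomy : ∀ {P : Pred A 0ℓ} (P? : Decidable P) a → ¬ P a →
    1 + ∑ (λ x → ⟦ P? x ⟧) + ∑ (λ x → ⟦ ¬? (x ≟ a) ×-dec ¬? (P? x) ⟧) ≡ n
  ∑-trichotomy P? a ¬Pa = begin
    1 + ∑ χ + ∑ rest
      ≡⟨ cong (λ k → k + ∑ χ + ∑ rest) (sym (∑-indicator a)) ⟩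
    ∑ (λ x → ⟦ x ≟ a ⟧) + ∑ χ + ∑ rest
      ≡⟨ cong (_+ ∑ rest) (sym (∑-distrib-+ (λ x → ⟦ x ≟ a ⟧) χ)) ⟩
    ∑ (λ x → ⟦ x ≟ a ⟧ + χ x) + ∑ rest
      ≡⟨ sym (∑-distrib-+ (λ x → ⟦ x ≟ a ⟧ + χ x) rest) ⟩
    ∑ (λ x → ⟦ x ≟ a ⟧ + χ x + rest x)
      ≡⟨ ∑-cong (λ x → ⟦⟧-trichotomy (x ≟ a) (P? x) (λ { refl → ¬Pa })) ⟩
    ∑ (λ _ → 1)
      ≡⟨ ∑-one ⟩
    n ∎
    where
    open ≡-Reasoning
    χ rest : A → ℕ
    χ x = ⟦ P? x ⟧
    rest x = ⟦ ¬? (x ≟ a) ×-dec ¬? (P? x) ⟧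

  length-filter-elements : ∀ {P : Pred A 0ℓ} (P? : Decidable P) →
    length (filter P? (map from (allFin n))) ≡ ∑ (λ x → ⟦ P? x ⟧)
  length-filter-elements P? =
    trans (cong (length ∘ filter P?) (map-tabulate (λ i → i) from)) (length-filter-tabulate P? from)

  length-filter-elements² : ∀ {P : Pred (A × A) 0ℓ} (P? : Decidable P) →
    let elements = map from (allFin n) in
    length (filter P? (cartesianProduct elements elements)) ≡ ∑ (λ x → ∑ (λ y → ⟦ P? (x , y) ⟧))
  length-filter-elements² P? = trans
    (cong (λ xs → length (filter P? (cartesianProduct xs xs))) (map-tabulate (λ i → i) from))
    (length-filter-cartesianProduct P? from from)

  ∑²≤-injective : ∀ {P : Pred A 0ℓ} (P? : Decidable P) (g : A → A → A) →
    (∀ {a b a′ b′} → P a → P b → P a′ → P b′ → g a b ≡ g a′ b′ → a ≡ a′ × b ≡ b′) →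
    ∑ (λ x → ⟦ P? x ⟧) * ∑ (λ x → ⟦ P? x ⟧) ≤ n
  ∑²≤-injective {P} P? g injective = begin
    ∑ χ * ∑ χ
      ≡⟨ sym (∑-*ˡ (∑ χ) χ) ⟩
    ∑ (λ a → ∑ χ * χ a)
      ≡⟨ ∑-cong (λ a → trans (*-comm (∑ χ) (χ a)) (sym (∑-*ˡ (χ a) χ))) ⟩
    ∑ (λ a → ∑ (λ b → χ a * χ b))
      ≡⟨ ∑-cong (λ a → ∑-cong (λ b → sym (∑-hits a b))) ⟩
    ∑ (λ a → ∑ (λ b → ∑ (λ z → hit z a b)))
      ≡⟨ ∑-cong (λ a → ∑-comm (λ b z → hit z a b)) ⟩
    ∑ (λ a → ∑ (λ z → ∑ (λ b → hit z a b)))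
      ≡⟨ ∑-comm (λ a z → ∑ (λ b → hit z a b)) ⟩
    ∑ (λ z → ∑ (λ a → ∑ (λ b → hit z a b)))
      ≤⟨ ∑-mono fibre≤1 ⟩
    ∑ (λ _ → 1)
      ≡⟨ ∑-one ⟩
    n ∎
    where
    open ≤-Reasoning
    χ : A → ℕ
    χ x = ⟦ P? x ⟧

    hit : A → A → A → ℕ
    hit z a b = ⟦ g a b ≟ z ×-dec (P? a ×-dec P? b) ⟧

    ∑-hits : ∀ a b → ∑ (λ z → hit z a b) ≡ χ a * χ b
    ∑-hits a b = begin-equality
      ∑ (λ z → hit z a b)
        ≡⟨ ∑-cong (λ z → ⟦×-dec⟧ (g a b ≟ z) (P? a ×-dec P? b)) ⟩
      ∑ (λ z → ⟦ g a b ≟ z ⟧ * ⟦ P? a ×-dec P? b ⟧)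
        ≡⟨ ∑-point (g a b) (λ _ → ⟦ P? a ×-dec P? b ⟧) ⟩
      ⟦ P? a ×-dec P? b ⟧
        ≡⟨ ⟦×-dec⟧ (P? a) (P? b) ⟩
      χ a * χ b ∎

    hit-sound : ∀ {z a b} → 0 < hit z a b → g a b ≡ z × P a × P b
    hit-sound {z} {a} {b} = ⟦⟧-sound (g a b ≟ z ×-dec (P? a ×-dec P? b))

    fibre≤1 : ∀ z → ∑ (λ a → ∑ (λ b → hit z a b)) ≤ 1
    fibre≤1 z = ∑-atMostOne _ row≤1 λ a a′ row>0 row′>0 →
      let b  , hit>0  = ∑-pos (hit z a) row>0
          b′ , hit′>0 = ∑-pos (hit z a′) row′>0
          gab≡z  , Pa  , Pb  = hit-sound hit>0
          ga′b′≡z , Pa′ , Pb′ = hit-sound hit′>0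
      in proj₁ (injective Pa Pb Pa′ Pb′ (trans gab≡z (sym ga′b′≡z)))
      where
      row≤1 : ∀ a → ∑ (λ b → hit z a b) ≤ 1
      row≤1 a = ∑-atMostOne _ (λ b → ⟦⟧≤1 (g a b ≟ z ×-dec (P? a ×-dec P? b))) λ b b′ hit>0 hit′>0 →
        let gab≡z  , Pa , Pb  = hit-sound hit>0
            gab′≡z , _  , Pb′ = hit-sound hit′>0
        in proj₂ (injective Pa Pb Pa Pb′ (trans gab≡z (sym gab′≡z)))

module FiniteFieldProperties {q : ℕ} (F : FiniteField q) where

  open FiniteField F renaming (_+_ to _⊕_; _*_ to _⊗_; -_ to ⊖_)
  open FieldDefs F

  ring : CommutativeRing 0ℓ 0ℓ
  ring = record
    { Carrier = Carrier ; _≈_ = _≡_ ; _+_ = _⊕_ ; _*_ = _⊗_ ; -_ = ⊖_ ; 0# = 0# ; 1# = 1#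
    ; isCommutativeRing = isCommutativeRing }

  module R = CommutativeRing ring
  module RP = Algebra.Properties.Ring R.ring

  x-y≡0⇒x≡y : ∀ {x y} → x - y ≡ 0# → x ≡ y
  x-y≡0⇒x≡y {x} {y} = RP.x∙y⁻¹≈ε⇒x≈y x y

  -[x-y]≡y-x : ∀ x y → ⊖ (x - y) ≡ y - x
  -[x-y]≡y-x = RP.⁻¹-anti-homo‿-

  [-y]-[-x]≡x-y : ∀ x y → ⊖ y - ⊖ x ≡ x - y
  [-y]-[-x]≡x-y x y = trans (cong (⊖ y ⊕_) (RP.-‿involutive x)) (R.+-comm (⊖ y) x)

  x*y≡1⇒x≢0 : ∀ {x y} → x ⊗ y ≡ 1# → x ≢ 0#
  x*y≡1⇒x≢0 {y = y} xy≡1 refl = 0≢1 (trans (sym (R.zeroˡ y)) xy≡1)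

  -1≢0 : ⊖ 1# ≢ 0#
  -1≢0 -1≡0 = 0≢1 (trans (sym RP.-0#≈0#) (trans (cong ⊖_ (sym -1≡0)) (RP.-‿involutive 1#)))

  inverse-unique : ∀ {x y y′} → x ⊗ y ≡ 1# → x ⊗ y′ ≡ 1# → y ≡ y′
  inverse-unique {x} {y} {y′} xy≡1 xy′≡1 = begin
    y             ≡⟨ sym (R.*-identityʳ y) ⟩
    y ⊗ 1#        ≡⟨ cong (y ⊗_) (sym xy′≡1) ⟩
    y ⊗ (x ⊗ y′)  ≡⟨ sym (R.*-assoc y x y′) ⟩
    y ⊗ x ⊗ y′    ≡⟨ cong (_⊗ y′) (trans (R.*-comm y x) xy≡1) ⟩
    1# ⊗ y′       ≡⟨ R.*-identityˡ y′ ⟩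
    y′            ∎
    where open ≡-Reasoning

  x*y≡z⇒x≡z*y⁻¹ : ∀ {x y z w} → x ⊗ y ≡ z → y ⊗ w ≡ 1# → x ≡ z ⊗ w
  x*y≡z⇒x≡z*y⁻¹ {x} {y} {z} {w} xy≡z yw≡1 = begin
    x             ≡⟨ sym (R.*-identityʳ x) ⟩
    x ⊗ 1#        ≡⟨ cong (x ⊗_) (sym yw≡1) ⟩
    x ⊗ (y ⊗ w)   ≡⟨ sym (R.*-assoc x y w) ⟩
    x ⊗ y ⊗ w     ≡⟨ cong (_⊗ w) xy≡z ⟩
    z ⊗ w         ∎
    where open ≡-Reasoning

  ^-homo-* : ∀ x m n → x ^ (m + n) ≡ x ^ m ⊗ x ^ n
  ^-homo-* x zero    n = sym (R.*-identityˡ (x ^ n))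
  ^-homo-* x (suc m) n = trans (cong (x ⊗_) (^-homo-* x m n)) (sym (R.*-assoc x (x ^ m) (x ^ n)))

  ^-assocʳ : ∀ x m n → (x ^ m) ^ n ≡ x ^ (m * n)
  ^-assocʳ x m zero    = cong (x ^_) (sym (*-zeroʳ m))
  ^-assocʳ x m (suc n) = begin
    x ^ m ⊗ (x ^ m) ^ n   ≡⟨ cong (x ^ m ⊗_) (^-assocʳ x m n) ⟩
    x ^ m ⊗ x ^ (m * n)   ≡⟨ sym (^-homo-* x m (m * n)) ⟩
    x ^ (m + m * n)       ≡⟨ cong (x ^_) (sym (*-suc m n)) ⟩
    x ^ (m * suc n)       ∎
    where open ≡-Reasoning

  1^n≡1 : ∀ n → 1# ^ n ≡ 1#
  1^n≡1 zero    = refl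
  1^n≡1 (suc n) = trans (R.*-identityˡ (1# ^ n)) (1^n≡1 n)

  open Enumerated enum _≟_

  module _ {P : Pred Carrier 0ℓ} (P? : Decidable P) where

    outside : ℕ
    outside = ∑ (λ d → ⟦ ¬? (d ≟ 0#) ×-dec ¬? (P? d) ⟧)

    Represents : Carrier → Carrier → Carrier → Set
    Represents d x y = P x × P y × x ≢ y × x - y ≡ d

    difference? : ∀ d x y → Dec (Represents d x y)
    difference? d x y = P? x ×-dec (P? y ×-dec (¬? (x ≟ y) ×-dec ((x - y) ≟ d)))

    row : Carrier → Carrier → ℕ
    row d x = ∑ (λ y → ⟦ difference? d x y ⟧)

    card≡∑ : card P? ≡ ∑ (λ x → ⟦ P? x ⟧)
    card≡∑ = length-filter-elements P?

    diffCount≡∑ : ∀ d → diffCount P? d ≡ ∑ (row d)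
    diffCount≡∑ d = length-filter-elements² _

    ∑-differences : ∀ x y → ∑ (λ d → ⟦ difference? d x y ⟧) ≡ ⟦ P? x ×-dec (P? y ×-dec ¬? (x ≟ y)) ⟧
    ∑-differences x y = trans
      (∑-cong (λ d → trans (⟦×-dec⟧-last (P? x) (P? y) (¬? (x ≟ y)) ((x - y) ≟ d)) (*-comm _ ⟦ (x - y) ≟ d ⟧)))
      (∑-point (x - y) (λ _ → ⟦ P? x ×-dec (P? y ×-dec ¬? (x ≟ y)) ⟧))

    ∑-diffCount : ∑ (diffCount P?) + card P? ≡ card P? * card P?
    ∑-diffCount = begin
      ∑ (diffCount P?) + card P?
        ≡⟨ cong (_+ card P?) (∑-cong diffCount≡∑) ⟩
      ∑ (λ d → ∑ (λ x → ∑ (λ y → ⟦ difference? d x y ⟧))) + card P?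
        ≡⟨ cong (_+ card P?) (∑-comm (λ d x → ∑ (λ y → ⟦ difference? d x y ⟧))) ⟩
      ∑ (λ x → ∑ (λ d → ∑ (λ y → ⟦ difference? d x y ⟧))) + card P?
        ≡⟨ cong (_+ card P?) (∑-cong (λ x → ∑-comm (λ d y → ⟦ difference? d x y ⟧))) ⟩
      ∑ (λ x → ∑ (λ y → ∑ (λ d → ⟦ difference? d x y ⟧))) + card P?
        ≡⟨ cong₂ _+_ (∑-cong (λ x → ∑-cong (∑-differences x))) card≡∑ ⟩
      ∑ (λ x → ∑ (λ y → ⟦ P? x ×-dec (P? y ×-dec ¬? (x ≟ y)) ⟧)) + ∑ (λ x → ⟦ P? x ⟧)
        ≡⟨ ∑-off-diagonal P? ⟩
      ∑ (λ x → ⟦ P? x ⟧) * ∑ (λ x → ⟦ P? x ⟧)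
        ≡⟨ sym (cong₂ _*_ card≡∑ card≡∑) ⟩
      card P? * card P? ∎
      where open ≡-Reasoning

    diffCount-0 : diffCount P? 0# ≡ 0
    diffCount-0 = begin
      diffCount P? 0#
        ≡⟨ diffCount≡∑ 0# ⟩
      ∑ (row 0#)
        ≡⟨ ∑-cong (λ x → ∑-cong (λ y → ⟦⟧-no (difference? 0# x y) not-represented)) ⟩
      ∑ (λ x → ∑ (λ y → 0))
        ≡⟨ ∑-cong (λ _ → ∑-zero) ⟩
      ∑ (λ x → 0)
        ≡⟨ ∑-zero ⟩
      0 ∎
      where
      open ≡-Reasoning
      not-represented : ∀ {x y} → ¬ Represents 0# x y
      not-represented (_ , _ , x≢y , x-y≡0) = x≢y (x-y≡0⇒x≡y x-y≡0)

    card+outside : ¬ P 0# → 1 + card P? + outside ≡ q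
    card+outside ¬P0 = trans (cong (λ k → 1 + k + outside) card≡∑) (∑-trichotomy P? 0# ¬P0)

    pds-count : ∀ {k λ′ μ} → IsPDS P? k λ′ μ → ¬ P 0# → λ′ * k + μ * outside + k ≡ k * k
    pds-count {k} {λ′} {μ} (card≡k , λ-count , μ-count) ¬P0 = begin
      λ′ * k + μ * outside + k
        ≡⟨ cong (λ k′ → λ′ * k′ + μ * outside + k′) (sym card≡k) ⟩
      λ′ * card P? + μ * outside + card P?
        ≡⟨ cong (_+ card P?) ∑-diffCount≡ ⟩
      ∑ (diffCount P?) + card P?
        ≡⟨ ∑-diffCount ⟩
      card P? * card P?
        ≡⟨ cong₂ _*_ card≡k card≡k ⟩
      k * k ∎
      where
      open ≡-Reasoning
      ν : Carrier → ℕ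
      ν d = ⟦ ¬? (d ≟ 0#) ×-dec ¬? (P? d) ⟧

      diffCount-pds : ∀ d → diffCount P? d ≡ λ′ * ⟦ P? d ⟧ + μ * ν d
      diffCount-pds d with d ≟ 0# | P? d
      ... | yes refl | yes P0  = ⊥-elim (¬P0 P0)
      ... | yes refl | no _    = trans diffCount-0 (sym (cong₂ _+_ (*-zeroʳ λ′) (*-zeroʳ μ)))
      ... | no _     | yes Pd  =
        trans (λ-count d Pd) (sym (trans (cong₂ _+_ (*-identityʳ λ′) (*-zeroʳ μ)) (+-identityʳ λ′)))
      ... | no d≢0   | no ¬Pd  =
        trans (μ-count d d≢0 ¬Pd) (sym (cong₂ _+_ (*-zeroʳ λ′) (*-identityʳ μ)))

      ∑-diffCount≡ : λ′ * card P? + μ * outside ≡ ∑ (diffCount P?)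
      ∑-diffCount≡ = sym (begin
        ∑ (diffCount P?)
          ≡⟨ ∑-cong diffCount-pds ⟩
        ∑ (λ d → λ′ * ⟦ P? d ⟧ + μ * ν d)
          ≡⟨ ∑-distrib-+ (λ d → λ′ * ⟦ P? d ⟧) (λ d → μ * ν d) ⟩
        ∑ (λ d → λ′ * ⟦ P? d ⟧) + ∑ (λ d → μ * ν d)
          ≡⟨ cong₂ _+_ (∑-*ˡ λ′ (λ d → ⟦ P? d ⟧)) (∑-*ˡ μ ν) ⟩
        λ′ * ∑ (λ d → ⟦ P? d ⟧) + μ * outside
          ≡⟨ cong (λ k′ → λ′ * k′ + μ * outside) (sym card≡∑) ⟩
        λ′ * card P? + μ * outside ∎)

    row≥1 : ∀ {d x y} → Represents d x y → 1 ≤ row d x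
    row≥1 {d} {x} {y} r = ≤-trans (≤-reflexive (sym (⟦⟧-yes (difference? d x y) r))) (∑-≥ _ y)

    diffCount-≥1 : ∀ {d x y} → Represents d x y → 1 ≤ diffCount P? d
    diffCount-≥1 {d} {x} r = subst (1 ≤_) (sym (diffCount≡∑ d)) (≤-trans (row≥1 r) (∑-≥ (row d) x))

    diffCount-≥2 : ∀ {d x y x′ y′} → Represents d x y → Represents d x′ y′ → x ≢ x′ → 2 ≤ diffCount P? d
    diffCount-≥2 {d} r r′ x≢x′ =
      subst (2 ≤_) (sym (diffCount≡∑ d)) (≤-trans (+-mono-≤ (row≥1 r) (row≥1 r′)) (∑-≥₂ (row d) x≢x′))

    represented : ∀ {d} → 0 < diffCount P? d → ∃ λ x → ∃ λ y → Represents d x y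
    represented {d} pos with ∑-pos (row d) (subst (0 <_) (diffCount≡∑ d) pos)
    ... | x , row>0 = x , ∃-of-∑ (difference? d x) row>0

  a+u≡a′+u′⇒u-u′≡a′-a : ∀ {a a′ u u′} → a ⊕ u ≡ a′ ⊕ u′ → u - u′ ≡ a′ - a
  a+u≡a′+u′⇒u-u′≡a′-a {a} {a′} {u} {u′} eq = begin
    u - u′                  ≡⟨ sym (R.+-identityˡ (u - u′)) ⟩
    0# ⊕ (u - u′)           ≡⟨ cong (_⊕ (u - u′)) (sym (R.-‿inverseʳ a)) ⟩
    (a - a) ⊕ (u - u′)      ≡⟨ cong (_⊕ (u - u′)) (R.+-comm a (⊖ a)) ⟩
    (⊖ a ⊕ a) ⊕ (u - u′)    ≡⟨ R.+-assoc (⊖ a) a (u - u′) ⟩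
    ⊖ a ⊕ (a ⊕ (u - u′))    ≡⟨ cong (⊖ a ⊕_) (sym (R.+-assoc a u (⊖ u′))) ⟩
    ⊖ a ⊕ ((a ⊕ u) - u′)    ≡⟨ cong (λ z → ⊖ a ⊕ (z - u′)) eq ⟩
    ⊖ a ⊕ ((a′ ⊕ u′) - u′)  ≡⟨ cong (⊖ a ⊕_) (R.+-assoc a′ u′ (⊖ u′)) ⟩
    ⊖ a ⊕ (a′ ⊕ (u′ - u′))  ≡⟨ cong (λ z → ⊖ a ⊕ (a′ ⊕ z)) (R.-‿inverseʳ u′) ⟩
    ⊖ a ⊕ (a′ ⊕ 0#)         ≡⟨ cong (⊖ a ⊕_) (R.+-identityʳ a′) ⟩
    ⊖ a ⊕ a′                ≡⟨ R.+-comm (⊖ a) a′ ⟩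
    a′ - a                  ∎
    where open ≡-Reasoning

  -- (a , b) ↦ a + t b is injective on K × K.
  subfield-card² : ∀ {K : Pred Carrier 0ℓ} (K? : Decidable K) → IsSubfield K →
    ∀ {t} → ¬ K t → card K? * card K? ≤ q
  subfield-card² {K} K? (_ , _ , K-+ , K-neg , K-* , K-inv) {t} ¬Kt =
    subst (λ k → k * k ≤ q) (sym (card≡∑ K?)) (∑²≤-injective K? (λ a b → a ⊕ t ⊗ b) injective)
    where
    K-sub : ∀ x y → K x → K y → K (x - y)
    K-sub x y Kx Ky = K-+ x (⊖ y) Kx (K-neg y Ky)

    injective : ∀ {a b a′ b′} → K a → K b → K a′ → K b′ → a ⊕ t ⊗ b ≡ a′ ⊕ t ⊗ b′ → a ≡ a′ × b ≡ b′
    injective {a} {b} {a′} {b′} Ka Kb Ka′ Kb′ eq with b ≟ b′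
    ... | yes refl = RP.+-cancelʳ (t ⊗ b) a a′ eq , refl
    ... | no b≢b′  =
      ⊥-elim (¬Kt (subst K (sym t≡) (K-* _ _ (K-sub a′ a Ka′ Ka) (K-inv u u≢0 (K-sub b b′ Kb Kb′)))))
      where
      u : Carrier
      u = b - b′
      u≢0 : u ≢ 0#
      u≢0 = b≢b′ ∘ x-y≡0⇒x≡y
      t≡ : t ≡ (a′ - a) ⊗ proj₁ (inverse u u≢0)
      t≡ = x*y≡z⇒x≡z*y⁻¹ (trans (RP.x[y-z]≈xy-xz t b b′) (a+u≡a′+u′⇒u-u′≡a′-a eq)) (proj₂ (inverse u u≢0))

  primitive≢0 : 2 < q → ∀ {α} → Primitive α → α ≢ 0#
  primitive≢0 2<q {α} prim refl = <⇒≱ 2<q (begin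
    q
      ≡⟨ sym ∑-one ⟩
    ∑ (λ _ → 1)
      ≤⟨ ∑-mono zero-or-one ⟩
    ∑ (λ x → ⟦ x ≟ 0# ⟧ + ⟦ x ≟ 1# ⟧)
      ≡⟨ ∑-distrib-+ (λ x → ⟦ x ≟ 0# ⟧) (λ x → ⟦ x ≟ 1# ⟧) ⟩
    ∑ (λ x → ⟦ x ≟ 0# ⟧) + ∑ (λ x → ⟦ x ≟ 1# ⟧)
      ≡⟨ cong₂ _+_ (∑-indicator 0#) (∑-indicator 1#) ⟩
    2 ∎)
    where
    open ≤-Reasoning
    zero-or-one : ∀ x → 1 ≤ ⟦ x ≟ 0# ⟧ + ⟦ x ≟ 1# ⟧
    zero-or-one x with x ≟ 0#
    ... | yes _   = s≤s z≤n
    ... | no x≢0 with prim x x≢0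
    ...   | zero  , x≡1 = ≤-reflexive (sym (⟦⟧-yes (x ≟ 1#) x≡1))
    ...   | suc i , x≡0*αⁱ = ⊥-elim (x≢0 (trans x≡0*αⁱ (R.zeroˡ (α ^ i))))

  primitive-finite-order : ∀ {α} → Primitive α → α ≢ 0# → ∃ λ k → α ^ suc k ≡ 1#
  primitive-finite-order {α} prim α≢0 with inverse α α≢0
  ... | γ , αγ≡1 with prim γ (x*y≡1⇒x≢0 (trans (R.*-comm γ α) αγ≡1))
  ...   | k , γ≡αᵏ = k , trans (cong (α ⊗_) (sym γ≡αᵏ)) αγ≡1

  module CyclotomicClass {α k} (α^[1+k]≡1 : α ^ suc k ≡ 1#) (e : ℕ) where

    β : Carrier
    β = α ^ e

    β^[1+k]≡1 : β ^ suc k ≡ 1#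
    β^[1+k]≡1 = begin
      β ^ suc k           ≡⟨ ^-assocʳ α e (suc k) ⟩
      α ^ (e * suc k)     ≡⟨ cong (α ^_) (*-comm e (suc k)) ⟩
      α ^ (suc k * e)     ≡⟨ sym (^-assocʳ α (suc k) e) ⟩
      (α ^ suc k) ^ e     ≡⟨ cong (_^ e) α^[1+k]≡1 ⟩
      1# ^ e              ≡⟨ 1^n≡1 e ⟩
      1#                  ∎
      where open ≡-Reasoning

    βⁱ*βᵏⁱ≡1 : ∀ i → β ^ i ⊗ β ^ (k * i) ≡ 1#
    βⁱ*βᵏⁱ≡1 i = begin
      β ^ i ⊗ β ^ (k * i)   ≡⟨ sym (^-homo-* β i (k * i)) ⟩
      β ^ (suc k * i)       ≡⟨ sym (^-assocʳ β (suc k) i) ⟩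
      (β ^ suc k) ^ i       ≡⟨ cong (_^ i) β^[1+k]≡1 ⟩
      1# ^ i                ≡⟨ 1^n≡1 i ⟩
      1#                    ∎
      where open ≡-Reasoning

    C₀-1 : C₀ α e 1#
    C₀-1 = 0 , refl

    C₀-* : ∀ {x y} → C₀ α e x → C₀ α e y → C₀ α e (x ⊗ y)
    C₀-* (i , refl) (j , refl) = i + j , sym (^-homo-* β i j)

    C₀-≢0 : ∀ {x} → C₀ α e x → x ≢ 0#
    C₀-≢0 (i , refl) = x*y≡1⇒x≢0 (βⁱ*βᵏⁱ≡1 i)

    C₀-inverse : ∀ {x} → C₀ α e x → (x≢0 : x ≢ 0#) → C₀ α e (proj₁ (inverse x x≢0))
    C₀-inverse (i , refl) x≢0 = k * i , inverse-unique (proj₂ (inverse _ x≢0)) (βⁱ*βᵏⁱ≡1 i)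

-- N is the number of nonzero elements outside a PDS of size f in GF(q), where q = (1 + e′) f + 1.
pds-parameters : ∀ f e′ λ′ μ N → .{{NonZero f}} →
  λ′ * f + μ * N + f ≡ f * f → 1 + f + N ≡ suc e′ * f + 1 → f ≡ suc (λ′ + μ * e′)
pds-parameters f e′ λ′ μ N count size = *-cancelʳ-≡ f (suc (λ′ + μ * e′)) f (begin
  f * f                       ≡⟨ sym count ⟩
  λ′ * f + μ * N + f          ≡⟨ cong (λ m → λ′ * f + μ * m + f) N≡e′f ⟩
  λ′ * f + μ * (e′ * f) + f   ≡⟨ expand f e′ λ′ μ ⟩
  suc (λ′ + μ * e′) * f       ∎)
  where
  open ≡-Reasoning
  N≡e′f : N ≡ e′ * f
  N≡e′f = +-cancelˡ-≡ f N (e′ * f) (suc-injective (trans size (+-comm (f + e′ * f) 1)))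
  expand : ∀ f e′ λ′ μ → λ′ * f + μ * (e′ * f) + f ≡ suc (λ′ + μ * e′) * f
  expand = solve-∀

μ≡0-if-f≤e′ : ∀ {f e′ λ′ μ} → f ≤ e′ → f ≡ suc (λ′ + μ * e′) → μ ≡ 0
μ≡0-if-f≤e′ {μ = zero}            _    _  = refl
μ≡0-if-f≤e′ {f} {e′} {λ′} {suc μ} f≤e′ f≡ = ⊥-elim (<⇒≱ e′<f f≤e′)
  where
  e′<f : e′ < f
  e′<f = subst (e′ <_) (sym f≡) (s≤s (≤-trans (m≤m+n e′ (μ * e′)) (m≤n+m (e′ + μ * e′) λ′)))

μ≡0-or-μ≡1∧λ≡0 : ∀ {e′ λ′ μ} → 1 ≤ e′ → suc e′ ≡ suc (λ′ + μ * e′) → μ ≡ 0 ⊎ (μ ≡ 1 × λ′ ≡ 0)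
μ≡0-or-μ≡1∧λ≡0 {μ = zero}                   _    _  = inj₁ refl
μ≡0-or-μ≡1∧λ≡0 {e′} {λ′} {suc zero}      _    eq = inj₂ (refl , +-cancelʳ-≡ e′ λ′ 0 (sym e′≡λ′+e′))
  where
  e′≡λ′+e′ : e′ ≡ λ′ + e′
  e′≡λ′+e′ = trans (suc-injective eq) (cong (λ′ +_) (+-identityʳ e′))
μ≡0-or-μ≡1∧λ≡0 {e′} {λ′} {suc (suc μ)} 1≤e′ eq = ⊥-elim (<⇒≱ e′<e′+e′ (begin
  e′ + e′                        ≤⟨ +-monoʳ-≤ e′ (m≤m+n e′ (μ * e′)) ⟩
  e′ + (e′ + μ * e′)             ≤⟨ m≤n+m (e′ + (e′ + μ * e′)) λ′ ⟩
  λ′ + suc (suc μ) * e′          ≡⟨ sym (suc-injective eq) ⟩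
  e′                             ∎))
  where
  open ≤-Reasoning
  e′<e′+e′ : e′ < e′ + e′
  e′<e′+e′ = m<m+n e′ 1≤e′

square-exceeds : ∀ e f → 1 ≤ f → e ≤ f → e * f + 1 < suc f * suc f
square-exceeds e f 1≤f e≤f = begin-strict
  e * f + 1                ≤⟨ +-monoˡ-≤ 1 (*-monoˡ-≤ f e≤f) ⟩
  f * f + 1                <⟨ m<m+n (f * f + 1) (≤-trans 1≤f (m≤m+n f f)) ⟩
  f * f + 1 + (f + f)      ≡⟨ square-suc f ⟩
  suc f * suc f            ∎
  where
  open ≤-Reasoning
  square-suc : ∀ f → f * f + 1 + (f + f) ≡ suc f * suc f
  square-suc = solve-∀

module CyclotomicPDS {q e f λ′ μ : ℕ} (F : FiniteField q) {α : FiniteField.Carrier F}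
  (q≡ef+1 : q ≡ e * f + 1) (1<e : 1 < e) (1<f : 1 < f)
  (prim : FieldDefs.Primitive F α) (C? : Decidable (FieldDefs.C₀ F α e))
  (pds : FieldDefs.IsPDS F C? f λ′ μ) where

  open FiniteField F renaming (_+_ to _⊕_; _*_ to _⊗_; -_ to ⊖_)
  open FieldDefs F
  open FiniteFieldProperties F
  open Enumerated enum _≟_

  C K : Pred Carrier 0ℓ
  C = C₀ α e
  K = C₀∪0 α e

  1≤f : 1 ≤ f
  1≤f = <⇒≤ 1<f

  2<q : 2 < q
  2<q = subst (2 <_) (sym q≡ef+1) (+-monoˡ-≤ 1 (*-mono-≤ 1<e 1≤f))

  finite-order : ∃ λ k → α ^ suc k ≡ 1#
  finite-order = primitive-finite-order prim (primitive≢0 2<q prim)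

  open CyclotomicClass {k = proj₁ finite-order} (proj₂ finite-order) e

  ¬C0 : ¬ C 0#
  ¬C0 C0 = C₀-≢0 C0 refl

  ∑C≡f : ∑ (λ x → ⟦ C? x ⟧) ≡ f
  ∑C≡f = trans (sym (card≡∑ C?)) (proj₁ pds)

  λ-count : ∀ d → C d → diffCount C? d ≡ λ′
  λ-count = proj₁ (proj₂ pds)

  μ-count : ∀ d → d ≢ 0# → ¬ C d → diffCount C? d ≡ μ
  μ-count = proj₂ (proj₂ pds)

  e′ : ℕ
  e′ = pred e

  e≡1+e′ : e ≡ suc e′
  e≡1+e′ = sym (suc-pred e {{>-nonZero (<-trans z<s 1<e)}})

  1≤e′ : 1 ≤ e′
  1≤e′ = ≤-pred (subst (2 ≤_) e≡1+e′ 1<e)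

  f≡1+λ+μe′ : f ≡ suc (λ′ + μ * e′)
  f≡1+λ+μe′ =
    pds-parameters f e′ λ′ μ (outside C?) {{>-nonZero (<-trans z<s 1<f)}} (pds-count C? pds ¬C0) (begin
      1 + f + outside C?         ≡⟨ cong (λ k → 1 + k + outside C?) (sym (proj₁ pds)) ⟩
      1 + card C? + outside C?   ≡⟨ card+outside C? ¬C0 ⟩
      q                          ≡⟨ q≡ef+1 ⟩
      e * f + 1                  ≡⟨ cong (λ k → k * f + 1) e≡1+e′ ⟩
      suc e′ * f + 1             ∎)
    where open ≡-Reasoning

  C-closed-under-differences : μ ≡ 0 → ∀ {x y} → C x → C y → x ≢ y → C (x - y)
  C-closed-under-differences μ≡0 {x} {y} Cx Cy x≢y with C? (x - y)
  ... | yes C[x-y] = C[x-y]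
  ... | no ¬C[x-y] = ⊥-elim (<⇒≱ (diffCount-≥1 C? (Cx , Cy , x≢y , refl))
                                 (≤-reflexive (trans (μ-count (x - y) (x≢y ∘ x-y≡0⇒x≡y) ¬C[x-y]) μ≡0)))

  C-neg : C (⊖ 1#) → ∀ {x} → C x → C (⊖ x)
  C-neg C[-1] {x} Cx = subst C (RP.-1*x≈-x x) (C₀-* C[-1] Cx)

  -1∈C : μ ≡ 0 → C (⊖ 1#)
  -1∈C μ≡0 with ∃-≢ C? (subst (1 <_) (sym ∑C≡f) 1<f) 1#
  ... | c , Cc , c≢1 = subst C quotient≡-1 (C₀-* C[c-1] (C₀-inverse C[1-c] (C₀-≢0 C[1-c])))
    where
    C[1-c] : C (1# - c)
    C[1-c] = C-closed-under-differences μ≡0 C₀-1 Cc (c≢1 ∘ sym)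
    C[c-1] : C (c - 1#)
    C[c-1] = C-closed-under-differences μ≡0 Cc C₀-1 c≢1
    w : Carrier
    w = proj₁ (inverse (1# - c) (C₀-≢0 C[1-c]))
    quotient≡-1 : (c - 1#) ⊗ w ≡ ⊖ 1#
    quotient≡-1 = begin
      (c - 1#) ⊗ w        ≡⟨ cong (_⊗ w) (sym (-[x-y]≡y-x 1# c)) ⟩
      ⊖ (1# - c) ⊗ w      ≡⟨ sym (RP.-‿distribˡ-* (1# - c) w) ⟩
      ⊖ ((1# - c) ⊗ w)    ≡⟨ cong ⊖_ (proj₂ (inverse (1# - c) (C₀-≢0 C[1-c]))) ⟩
      ⊖ 1#                ∎
      where open ≡-Reasoning

  μ≡0⇒subfield : μ ≡ 0 → IsSubfield K
  μ≡0⇒subfield μ≡0 = inj₁ refl , inj₂ C₀-1 , K-+ , K-neg , K-* , K-inverse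
    where
    K-+ : ∀ x y → K x → K y → K (x ⊕ y)
    K-+ x y (inj₁ refl) Ky = subst K (sym (R.+-identityˡ y)) Ky
    K-+ x y (inj₂ Cx) (inj₁ refl) = subst K (sym (R.+-identityʳ x)) (inj₂ Cx)
    K-+ x y (inj₂ Cx) (inj₂ Cy) with x ≟ (⊖ y)
    ... | yes refl = inj₁ (R.-‿inverseˡ y)
    ... | no x≢-y  = inj₂ (subst C (cong (x ⊕_) (RP.-‿involutive y))
                                  (C-closed-under-differences μ≡0 Cx (C-neg (-1∈C μ≡0) Cy) x≢-y))

    K-neg : ∀ x → K x → K (⊖ x)
    K-neg x (inj₁ refl) = inj₁ RP.-0#≈0#
    K-neg x (inj₂ Cx)   = inj₂ (C-neg (-1∈C μ≡0) Cx)

    K-* : ∀ x y → K x → K y → K (x ⊗ y)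
    K-* x y (inj₁ refl) _           = inj₁ (R.zeroˡ y)
    K-* x y (inj₂ _)    (inj₁ refl) = inj₁ (R.zeroʳ x)
    K-* x y (inj₂ Cx)   (inj₂ Cy)   = inj₂ (C₀-* Cx Cy)

    K-inverse : ∀ x (x≢0 : x ≢ 0#) → K x → K (proj₁ (inverse x x≢0))
    K-inverse x x≢0 (inj₁ x≡0) = ⊥-elim (x≢0 x≡0)
    K-inverse x x≢0 (inj₂ Cx)  = inj₂ (C₀-inverse Cx x≢0)

  K? : Decidable K
  K? x = (x ≟ 0#) ⊎-dec C? x

  ∑K≡1+f : ∑ (λ x → ⟦ K? x ⟧) ≡ suc f
  ∑K≡1+f = begin
    ∑ (λ x → ⟦ K? x ⟧)
      ≡⟨ ∑-cong (λ x → ⟦⊎-dec⟧ (x ≟ 0#) (C? x) (λ { refl → ¬C0 })) ⟩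
    ∑ (λ x → ⟦ x ≟ 0# ⟧ + ⟦ C? x ⟧)
      ≡⟨ ∑-distrib-+ (λ x → ⟦ x ≟ 0# ⟧) (λ x → ⟦ C? x ⟧) ⟩
    ∑ (λ x → ⟦ x ≟ 0# ⟧) + ∑ (λ x → ⟦ C? x ⟧)
      ≡⟨ cong₂ _+_ (∑-indicator 0#) ∑C≡f ⟩
    suc f ∎
    where open ≡-Reasoning

  card-K : card K? ≡ suc f
  card-K = trans (card≡∑ K?) ∑K≡1+f

  1+f<q : suc f < q
  1+f<q = subst (suc f <_) (sym q≡ef+1) (≤-<-trans (begin
    suc f      ≤⟨ +-monoˡ-≤ f 1≤f ⟩
    f + f      ≡⟨ cong (f +_) (sym (+-identityʳ f)) ⟩
    2 * f      ≤⟨ *-monoˡ-≤ f 1<e ⟩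
    e * f      ∎) (m<m+n (e * f) z<s))
    where open ≤-Reasoning

  e≤f⇒¬subfield : e ≤ f → ¬ IsSubfield K
  e≤f⇒¬subfield e≤f K-subfield with ∃-∉ K? (subst (_< q) (sym ∑K≡1+f) 1+f<q)
  ... | t , ¬Kt = <⇒≱ (square-exceeds e f 1≤f e≤f)
                      (subst₂ _≤_ (cong₂ _*_ card-K card-K) q≡ef+1 (subfield-card² K? K-subfield ¬Kt))

  λ≡0⇒differences∉C : λ′ ≡ 0 → ∀ {x y} → C x → C y → x ≢ y → ¬ C (x - y)
  λ≡0⇒differences∉C λ≡0 {x} {y} Cx Cy x≢y C[x-y] =
    <⇒≱ (diffCount-≥1 C? (Cx , Cy , x≢y , refl)) (≤-reflexive (trans (λ-count (x - y) C[x-y]) λ≡0))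

  -- If -1 ∉ C, the unique representation x - y = -1 puts 1 = y - x among the differences; if -1 ∈ C,
  -- then 1 - c ∉ C is represented both as 1 - c and as (-c) - (-1).
  ¬[λ≡0∧μ≡1] : 2 < f → λ′ ≡ 0 → μ ≡ 1 → ⊥
  ¬[λ≡0∧μ≡1] 2<f λ≡0 μ≡1 with C? (⊖ 1#)
  ... | no ¬C[-1] with represented C? (subst (0 <_) (sym (trans (μ-count (⊖ 1#) -1≢0 ¬C[-1]) μ≡1)) z<s)
  ...   | x , y , Cx , Cy , x≢y , x-y≡-1 =
    λ≡0⇒differences∉C λ≡0 Cy Cx (x≢y ∘ sym) (subst C (sym y-x≡1) C₀-1)
    where
    y-x≡1 : y - x ≡ 1#
    y-x≡1 = trans (sym (-[x-y]≡y-x x y)) (trans (cong ⊖_ x-y≡-1) (RP.-‿involutive 1#))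
  ¬[λ≡0∧μ≡1] 2<f λ≡0 μ≡1 | yes C[-1] with ∃-≢₂ C? (subst (2 <_) (sym ∑C≡f) 2<f) 1# (⊖ 1#)
  ... | c , Cc , c≢1 , c≢-1 =
    <⇒≱ two-representations (≤-reflexive (trans (μ-count (1# - c) 1-c≢0 ¬C[1-c]) μ≡1))
    where
    ¬C[1-c] : ¬ C (1# - c)
    ¬C[1-c] = λ≡0⇒differences∉C λ≡0 C₀-1 Cc (c≢1 ∘ sym)
    1-c≢0 : 1# - c ≢ 0#
    1-c≢0 = c≢1 ∘ sym ∘ x-y≡0⇒x≡y
    1≢-c : 1# ≢ ⊖ c
    1≢-c 1≡-c = c≢-1 (trans (sym (RP.-‿involutive c)) (cong ⊖_ (sym 1≡-c)))
    -c≢-1 : ⊖ c ≢ ⊖ 1#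
    -c≢-1 = c≢1 ∘ RP.-‿injective
    two-representations : 2 ≤ diffCount C? (1# - c)
    two-representations = diffCount-≥2 C? (C₀-1 , Cc , c≢1 ∘ sym , refl)
                                          (C-neg C[-1] Cc , C[-1] , -c≢-1 , [-y]-[-x]≡x-y 1# c) 1≢-c

  e≡f⇒f≤2 : e ≡ f → ¬ 2 < f
  e≡f⇒f≤2 e≡f 2<f with μ≡0-or-μ≡1∧λ≡0 1≤e′ (trans (trans (sym e≡1+e′) e≡f) f≡1+λ+μe′)
  ... | inj₁ μ≡0         = e≤f⇒¬subfield (≤-reflexive e≡f) (μ≡0⇒subfield μ≡0)
  ... | inj₂ (μ≡1 , λ≡0) = ¬[λ≡0∧μ≡1] 2<f λ≡0 μ≡1

open import Data.Nat using (_^_)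

theorem4p5 : (q e f λ' μ : ℕ) (F : FiniteField q) (α : FiniteField.Carrier F)
    → (∃₂ λ p β → Prime p × q ≡ p ^ β)
    → q ≡ e * f + 1 → 1 < e → 1 < f
    → FieldDefs.Primitive F α
    → (C? : Decidable (FieldDefs.C₀ F α e))
    → FieldDefs.IsProperPDS F C? f λ' μ
    → (e > f → FieldDefs.IsSubfield F (FieldDefs.C₀∪0 F α e))
      × (e < f → ¬ FieldDefs.IsSubfield F (FieldDefs.C₀∪0 F α e) × 1 ≤ μ)
      × (e ≡ f → ¬ (f > 2))
theorem4p5 q e f λ′ μ F α _ q≡ef+1 1<e 1<f prim C? (pds , _) =
    (λ f<e → μ≡0⇒subfield (μ≡0-if-f≤e′ (≤-pred (subst (f <_) e≡1+e′ f<e)) f≡1+λ+μe′))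
  , (λ e<f → let ¬subfield = e≤f⇒¬subfield (<⇒≤ e<f)
             in ¬subfield , n≢0⇒n>0 (¬subfield ∘ μ≡0⇒subfield))
  , e≡f⇒f≤2
  where open CyclotomicPDS F q≡ef+1 1<e 1<f prim C? pds
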